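{- Let $(s_k)_{k\ge1}$ and $(t_k)_{k\ge1}$ be distinct sequences of positive integers such that $(s_k)$ lexicographically precedes $(t_k)$. Then there exists an integer $M\ge3$ such that $\mathcal{L}^{(s_k)}_n=\mathcal{L}^{(t_k)}_n$ for all $n<M$, but $\mathcal{L}^{(s_k)}_M\supsetneq\mathcal{L}^{(t_k)}_M$.
   Context: For a binary word $\gamma=\gamma_1\cdots\gamma_n$, its complement is $\overline{\gamma}=(1-\gamma_1)\cdots(1-\gamma_n)$. A factor of a word is a contiguous subword. Given a sequence $(s_k)_{k\ge1}$ of positive integers, define binary words $\alpha^{(s_k)}_1=01$ and, for $i\ge1$, $\alpha^{(s_k)}_{i+1}=(\alpha^{(s_k)}_i)^{s_i}(\overline{\alpha}^{(s_k)}_i)^{s_i}$. Let $\mathcal{L}^{(s_k)}$ be the set of all words (including the empty word) that are factors of $\alpha^{(s_k)}_i$ for some $i\ge1$, and $\mathcal{L}^{(s_k)}_n$ the set of words of length $n$ in $\mathcal{L}^{(s_k)}$. -}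

module Defs where

open import Data.Bool using (Bool; true; false; not)
open import Data.Nat using (ℕ; zero; suc; _<_; _≤_)
open import Data.List using (List; []; _∷_; _++_; map; length)
open import Data.Product using (Σ; ∃; _×_)
open import Relation.Binary.PropositionalEquality using (_≡_)
open import Relation.Nullary using (¬_)

-- Binary words: false = 0, true = 1.
Word : Set
Word = List Bool

complement : Word → Word
complement = map not

power : Word → ℕ → Word
power u zero    = []
power u (suc k) = u ++ power u k

-- A sequence (s_k)_{k≥1} is represented by s : ℕ → ℕ with  s i = s_{i+1}.
Seq : Set
Seq = ℕ → ℕ

Positive : Seq → Set
Positive s = ∀ k → 1 ≤ s k

-- α s i = α^{(s_k)}_{i+1}; so α s 0 = 01 and
-- α s (suc i) = (α s i)^{s_{i+1}} (complement (α s i))^{s_{i+1}}.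
α : Seq → ℕ → Word
α s zero    = false ∷ true ∷ []
α s (suc i) = power (α s i) (s i) ++ power (complement (α s i)) (s i)

Factor : Word → Word → Set
Factor w v = Σ Word λ u → Σ Word λ x → u ++ w ++ x ≡ v

InL : Seq → Word → Set
InL s w = ∃ λ i → Factor w (α s i)

SameLangAt : Seq → Seq → ℕ → Set
SameLangAt s t n = ∀ (w : Word) → length w ≡ n → (InL s w → InL t w) × (InL t w → InL s w)

StrictSupersetAt : Seq → Seq → ℕ → Set
StrictSupersetAt s t n =
  (∀ (w : Word) → length w ≡ n → InL t w → InL s w) ×
  (∃ λ (w : Word) → length w ≡ n × InL s w × ¬ InL t w)

LexLess : Seq → Seq → Set
LexLess s t = ∃ λ k → (∀ j → j < k → s j ≡ t j) × s k < t k

-- Write θ c for the substitution h ↦ (h h̄)^c.  Then α s (i+1) = θ (s 0) (α (shift s) i), so the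
-- words of L^(s) are the factors of θ (s 0) u for u in L^(shift s).  A double letter in θ c u can
-- only straddle a block boundary, which makes θ c recognisable: a factor x̄ θ c(v) y of θ c u, where
-- v contains two different adjacent letters, forces x v y to be a factor of u.
--
-- If s 0 = a < b = t 0, short factors of θ a and θ b come from short words lying in every language,
-- so the languages agree up to length 2a + 1 and L^(t) ⊆ L^(s) at length 2a + 2; but 0(01)^a 1
-- is in L^(s) and not in L^(t), since its two double letters are 2a apart.  If s 0 = t 0 = c, a
-- separating word x v y for the shifted sequences lifts to x̄ θ c(v) y for s and t, and agreement of
-- the shifted languages below length |v| + 2 lifts to agreement below length 2c|v| + 2.
module Submission where

open import Defs
open import Data.Nat using (ℕ; _<_; _≤_)
open import Data.Product using (∃; _×_)
open import Data.Bool using (Bool; true; false; not; _≟_)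
open import Data.Bool.Properties using (not-involutive; not-injective; not-¬; ¬-not)
open import Data.Nat using (zero; suc; _+_; _*_; _∸_; _⊓_; z≤n; s≤s; _≤?_)
open import Data.Nat.Properties
  using ( ≤-trans; ≤-reflexive; <⇒≤; ≰⇒>; n≤1+n; m≤m+n; m≤n+m; m≤m*n; ≤-pred; suc-injective
        ; +-comm; +-suc; +-identityʳ; *-distribʳ-+; +-monoˡ-≤; +-monoʳ-≤; *-monoˡ-≤
        ; +-cancelˡ-≤; *-distribʳ-⊓; *-distribʳ-∸; m+n∸n≡m; m∸n+n≡m; m+[n∸m]≡n; m<m+n; 1+n≰n; <-irrefl; <⇒≱; *-monoˡ-<; m≤n⇒∃[o]m+o≡n
        ; m≤n⇒m⊓n≡m; ⊓-glb; m⊓n≤m; module ≤-Reasoning )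
open import Data.List using ([]; _∷_; _++_; _∷ʳ_; map; length; take; drop; [_]; initLast; _∷ʳ′_)
open import Data.List.Properties
  using (++-conicalˡ; ++-conicalʳ; ++-monoid; ++-assoc; ++-identityʳ; ++-cancelˡ; length-++; map-++; ∷-injective; ∷ʳ-injective; length-take; take++drop≡id)
open import Data.Product using (∃₂; _,_; proj₁; proj₂; map₁)
open import Data.Sum using (_⊎_; inj₁; inj₂)
open import Data.Empty using (⊥-elim)
open import Function using (_∘_)
open import Relation.Binary.PropositionalEquality hiding ([_])
open import Relation.Nullary using (¬_; yes; no)
open import Tactic.MonoidSolver using (solve)


Prefix Suffix : Word → Word → Set
Prefix w v = ∃ λ x → w ++ x ≡ v
Suffix w v = ∃ λ x → x ++ w ≡ v

++-split : ∀ (a b c d : Word) → a ++ b ≡ c ++ d →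
  (∃ λ m → c ≡ a ++ m × b ≡ m ++ d) ⊎ (∃ λ m → a ≡ c ++ m × d ≡ m ++ b)
++-split []      b c       d eq = inj₁ (c , refl , eq)
++-split (x ∷ a) b []      d eq = inj₂ (x ∷ a , refl , sym eq)
++-split (x ∷ a) b (y ∷ c) d eq with ∷-injective eq
... | refl , eq′ with ++-split a b c d eq′
... | inj₁ (m , p , q) = inj₁ (m , cong (x ∷_) p , q)
... | inj₂ (m , p , q) = inj₂ (m , cong (x ∷_) p , q)

++-cancel-length : ∀ (a c : Word) {b d} → length a ≡ length c → a ++ b ≡ c ++ d → a ≡ c × b ≡ d
++-cancel-length []      []      _   eq = refl , eq
++-cancel-length (x ∷ a) (y ∷ c) len eq with ∷-injective eq
... | refl , eq′ = map₁ (cong (x ∷_)) (++-cancel-length a c (suc-injective len) eq′)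

length-++ˡ-≤ : ∀ (m n : Word) → length m ≤ length (m ++ n)
length-++ˡ-≤ m n = ≤-trans (m≤m+n (length m) (length n)) (≤-reflexive (sym (length-++ m)))

length-++ʳ-≤ : ∀ (m n : Word) → length n ≤ length (m ++ n)
length-++ʳ-≤ m n = ≤-trans (m≤n+m (length n) (length m)) (≤-reflexive (sym (length-++ m)))

++-length-≤ˡ⇒≡[] : ∀ (y : Word) {n} → length (y ++ n) ≤ length y → n ≡ []
++-length-≤ˡ⇒≡[] []      {[]} _        = refl
++-length-≤ˡ⇒≡[] (_ ∷ y)      (s≤s le) = ++-length-≤ˡ⇒≡[] y le

++-length-≤ʳ⇒≡[] : ∀ (n : Word) {y} → length (n ++ y) ≤ length y → n ≡ []
++-length-≤ʳ⇒≡[] []          _  = refl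
++-length-≤ʳ⇒≡[] (_ ∷ n) {y} le = ⊥-elim (1+n≰n (≤-trans (s≤s (length-++ʳ-≤ n y)) le))

factor-refl : ∀ w → Factor w w
factor-refl w = [] , [] , ++-identityʳ w

factor-trans : ∀ {a b c} → Factor a b → Factor b c → Factor a c
factor-trans {a} (p , q , refl) (p′ , q′ , refl) = p′ ++ p , q ++ q′ , (begin
  (p′ ++ p) ++ a ++ q ++ q′   ≡⟨ ++-assoc p′ p _ ⟩
  p′ ++ p ++ a ++ q ++ q′     ≡⟨ cong (λ z → p′ ++ p ++ z) (sym (++-assoc a q q′)) ⟩
  p′ ++ p ++ (a ++ q) ++ q′   ≡⟨ cong (p′ ++_) (sym (++-assoc p (a ++ q) q′)) ⟩
  p′ ++ (p ++ a ++ q) ++ q′   ∎)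
  where open ≡-Reasoning

factor-∷ : ∀ h {w v} → Factor w v → Factor w (h ∷ v)
factor-∷ h (p , q , eq) = h ∷ p , q , cong (h ∷_) eq

prefix⇒factor : ∀ {w v} → Prefix w v → Factor w v
prefix⇒factor (x , refl) = [] , x , refl

factor-across : ∀ {m n y z} → Suffix m y → Prefix n z → Factor (m ++ n) (y ++ z)
factor-across {m} {n} (x , refl) (x′ , refl) = x , x′ , (begin
  x ++ (m ++ n) ++ x′   ≡⟨ cong (x ++_) (++-assoc m n x′) ⟩
  x ++ m ++ n ++ x′     ≡⟨ sym (++-assoc x m _) ⟩
  (x ++ m) ++ n ++ x′   ∎)
  where open ≡-Reasoning

factor-++⁻ : ∀ w y z → Factor w (y ++ z) →
  Factor w y ⊎ Factor w z ⊎ ∃₂ λ m n → w ≡ m ++ n × Suffix m y × Prefix n z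
factor-++⁻ w y z (p , q , eq) with ++-split p (w ++ q) y z eq
... | inj₂ (m , refl , z≡) = inj₂ (inj₁ (m , q , sym z≡))
... | inj₁ (m , refl , w++q≡) with ++-split w q m z w++q≡
...   | inj₁ (m′ , refl , _)  = inj₁ (p , m′ , refl)
...   | inj₂ (n , refl , z≡) = inj₂ (inj₂ (m , n , refl , (p , refl) , (q , sym z≡)))

factor-map : ∀ f {w v} → Factor w v → Factor (map f w) (map f v)
factor-map f {w} (p , q , refl) = map f p , map f q ,
  sym (trans (map-++ f p (w ++ q)) (cong (map f p ++_) (map-++ f w q)))

prefix-trans : ∀ {a b c} → Prefix a b → Prefix b c → Prefix a c
prefix-trans {a} (x , refl) (y , refl) = x ++ y , sym (++-assoc a x y)

suffix-trans : ∀ {a b c} → Suffix a b → Suffix b c → Suffix a c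
suffix-trans {a} (x , refl) (y , refl) = y ++ x , ++-assoc y x a

prefix-++ : ∀ w z → Prefix w (w ++ z)
prefix-++ w z = z , refl

suffix-++ : ∀ w z → Suffix w (z ++ w)
suffix-++ w z = z , refl

prefix-map : ∀ f {w v} → Prefix w v → Prefix (map f w) (map f v)
prefix-map f {w} (x , refl) = map f x , sym (map-++ f w x)

prefix-++⁻ : ∀ {m} y z → Prefix m (y ++ z) → length m ≤ length y → Prefix m y
prefix-++⁻ {m} y z (q , eq) len with ++-split m q y z eq
... | inj₁ (n , y≡ , _) = n , sym y≡
... | inj₂ (n , refl , _) rewrite ++-length-≤ˡ⇒≡[] y len = [] , trans (++-identityʳ _) (++-identityʳ y)

suffix-++⁻ : ∀ {m} y z → Suffix m (y ++ z) → length m ≤ length z → Suffix m z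
suffix-++⁻ {m} y z (q , eq) len with ++-split q m y z eq
... | inj₂ (n , _ , z≡) = n , sym z≡
... | inj₁ (n , refl , refl) rewrite ++-length-≤ʳ⇒≡[] n len = [] , refl

power-+ : ∀ u m n → power u (m + n) ≡ power u m ++ power u n
power-+ u zero    n = refl
power-+ u (suc m) n = trans (cong (u ++_) (power-+ u m n)) (sym (++-assoc u (power u m) (power u n)))

power-sucʳ : ∀ u n → power u (suc n) ≡ power u n ++ u
power-sucʳ u n = begin
  power u (suc n)       ≡⟨ cong (power u) (+-comm 1 n) ⟩
  power u (n + 1)       ≡⟨ power-+ u n 1 ⟩
  power u n ++ u ++ []  ≡⟨ cong (power u n ++_) (++-identityʳ u) ⟩
  power u n ++ u        ∎
  where open ≡-Reasoning

length-power : ∀ u n → length (power u n) ≡ n * length u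
length-power u zero    = refl
length-power u (suc n) = trans (length-++ u) (cong (length u +_) (length-power u n))

map-power : ∀ f u n → map f (power u n) ≡ power (map f u) n
map-power f u zero    = refl
map-power f u (suc n) = trans (map-++ f u (power u n)) (cong (map f u ++_) (map-power f u n))

prefix-power : ∀ u n → 1 ≤ n → Prefix u (power u n)
prefix-power u (suc n) _ = power u n , refl

suffix-power : ∀ u n → 1 ≤ n → Suffix u (power u n)
suffix-power u (suc n) _ = power u n , sym (power-sucʳ u n)

power-prefix : ∀ u {k n} → k ≤ n → Prefix (power u k) (power u n)
power-prefix u {k} {n} k≤n = power u (n ∸ k) ,
  trans (sym (power-+ u k (n ∸ k))) (cong (power u) (m+[n∸m]≡n k≤n))

power-suffix : ∀ u {k n} → k ≤ n → Suffix (power u k) (power u n)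
power-suffix u {k} {n} k≤n = power u (n ∸ k) ,
  trans (sym (power-+ u (n ∸ k) k)) (cong (power u) (m∸n+n≡m k≤n))

prefix-power⁻ : ∀ {m} u k n → Prefix m (power u n) → length m ≤ k * length u → Prefix m (power u k)
prefix-power⁻ u k n pre len with k ≤? n
... | no  k≰n = prefix-trans pre (power-prefix u (<⇒≤ (≰⇒> k≰n)))
... | yes k≤n = prefix-++⁻ (power u k) (power u (n ∸ k))
  (subst (Prefix _) (trans (cong (power u) (sym (m+[n∸m]≡n k≤n))) (power-+ u k (n ∸ k))) pre)
  (subst (_ ≤_) (sym (length-power u k)) len)

suffix-power⁻ : ∀ {m} u k n → Suffix m (power u n) → length m ≤ k * length u → Suffix m (power u k)
suffix-power⁻ u k n suf len with k ≤? n
... | no  k≰n = suffix-trans suf (power-suffix u (<⇒≤ (≰⇒> k≰n)))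
... | yes k≤n = suffix-++⁻ (power u (n ∸ k)) (power u k)
  (subst (Suffix _) (trans (cong (power u) (sym (m∸n+n≡m k≤n))) (power-+ u (n ∸ k) k)) suf)
  (subst (_ ≤_) (sym (length-power u k)) len)

power-rotate : ∀ x y n → y ∷ power (x ∷ y ∷ []) n ≡ power (y ∷ x ∷ []) n ++ [ y ]
power-rotate x y zero    = refl
power-rotate x y (suc n) = cong (λ z → y ∷ x ∷ z) (power-rotate x y n)

block : ℕ → Bool → Word
block c h = power (h ∷ not h ∷ []) c

θ : ℕ → Word → Word
θ c []      = []
θ c (h ∷ u) = block c h ++ θ c u

shift : Seq → Seq
shift s k = s (suc k)

block-sucʳ : ∀ c h → block (suc c) h ≡ (block c h ++ [ h ]) ++ [ not h ]
block-sucʳ c h = trans (power-sucʳ _ c) (sym (++-assoc (block c h) [ h ] [ not h ]))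

θ-++ : ∀ c u v → θ c (u ++ v) ≡ θ c u ++ θ c v
θ-++ c []      v = refl
θ-++ c (h ∷ u) v = trans (cong (block c h ++_) (θ-++ c u v)) (sym (++-assoc (block c h) (θ c u) (θ c v)))

θ-power : ∀ c u n → θ c (power u n) ≡ power (θ c u) n
θ-power c u zero    = refl
θ-power c u (suc n) = trans (θ-++ c u (power u n)) (cong (θ c u ++_) (θ-power c u n))

θ-complement : ∀ c u → θ c (complement u) ≡ complement (θ c u)
θ-complement c []      = refl
θ-complement c (h ∷ u) = trans (cong₂ _++_ (sym (map-power not (h ∷ not h ∷ []) c)) (θ-complement c u))
  (sym (map-++ not (block c h) (θ c u)))

length-block : ∀ c h → length (block c h) ≡ c * 2
length-block c h = length-power (h ∷ not h ∷ []) c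

length-θ : ∀ c u → length (θ c u) ≡ length u * (c * 2)
length-θ c []      = refl
length-θ c (h ∷ u) = trans (length-++ (block c h)) (cong₂ _+_ (length-block c h) (length-θ c u))

factor-θ : ∀ c {w v} → Factor w v → Factor (θ c w) (θ c v)
factor-θ c {w} (p , q , refl) = θ c p , θ c q ,
  sym (trans (θ-++ c p (w ++ q)) (cong (θ c p ++_) (θ-++ c w q)))

θ-∷ʳ : ∀ c u h → θ (suc c) (u ∷ʳ h) ≡ (θ (suc c) u ++ block c h ++ [ h ]) ++ [ not h ]
θ-∷ʳ c u h = begin
  θ (suc c) (u ∷ʳ h)                               ≡⟨ θ-++ (suc c) u [ h ] ⟩
  θ (suc c) u ++ block (suc c) h ++ []             ≡⟨ cong (θ (suc c) u ++_) (++-identityʳ _) ⟩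
  θ (suc c) u ++ block (suc c) h                   ≡⟨ cong (θ (suc c) u ++_) (block-sucʳ c h) ⟩
  θ (suc c) u ++ (block c h ++ [ h ]) ++ [ not h ] ≡⟨ sym (++-assoc (θ (suc c) u) _ [ not h ]) ⟩
  (θ (suc c) u ++ block c h ++ [ h ]) ++ [ not h ] ∎
  where open ≡-Reasoning

α-suc : ∀ s i → α s (suc i) ≡ θ (s 0) (α (shift s) i)
α-suc s zero    = cong (power (false ∷ true ∷ []) (s 0) ++_) (sym (++-identityʳ _))
α-suc s (suc i) = begin
  power (α s (suc i)) n ++ power (complement (α s (suc i))) n
    ≡⟨ cong (λ z → power z n ++ power (complement z) n) (α-suc s i) ⟩
  power (θ c A) n ++ power (complement (θ c A)) n
    ≡⟨ cong (λ z → power (θ c A) n ++ power z n) (sym (θ-complement c A)) ⟩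
  power (θ c A) n ++ power (θ c (complement A)) n
    ≡⟨ sym (cong₂ _++_ (θ-power c A n) (θ-power c (complement A) n)) ⟩
  θ c (power A n) ++ θ c (power (complement A) n)
    ≡⟨ sym (θ-++ c (power A n) (power (complement A) n)) ⟩
  θ c (power A n ++ power (complement A) n)
    ∎
  where
  open ≡-Reasoning
  c = s 0
  n = s (suc i)
  A = α (shift s) i

InL-factor : ∀ s {w v} → Factor w v → InL s v → InL s w
InL-factor s f (i , g) = i , factor-trans f g

α-prefix : ∀ s → Positive s → ∀ i → Prefix (α s i) (α s (suc i))
α-prefix s pos i = prefix-trans (prefix-power (α s i) (s i) (pos i)) (prefix-++ _ _)

complement-factor : ∀ u n → 1 ≤ n → Factor (complement u) (power u n ++ power (complement u) n)
complement-factor u (suc n) _ = power u (suc n) , power (complement u) n , refl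

InL-desubst : ∀ s {w} → Positive s → InL s w → ∃ λ u → InL (shift s) u × Factor w (θ (s 0) u)
InL-desubst s pos (zero , f) = α (shift s) 0 , (0 , factor-refl _) ,
  subst (Factor _) (α-suc s 0) (factor-trans f (prefix⇒factor (α-prefix s pos 0)))
InL-desubst s pos (suc i , f) = α (shift s) i , (i , factor-refl _) , subst (Factor _) (α-suc s i) f

InL-subst : ∀ s {w u} → InL (shift s) u → Factor w (θ (s 0) u) → InL s w
InL-subst s (i , f) g = suc i , subst (Factor _) (sym (α-suc s i)) (factor-trans g (factor-θ (s 0) f))

InL-complement : ∀ s {w} → Positive s → InL s w → InL s (complement w)
InL-complement s pos (i , f) = suc i , factor-trans (factor-map not f) (complement-factor (α s i) (s i) (pos i))

Universal : Word → Set
Universal v = ∀ s → Positive s → InL s v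

universal-factor : ∀ {w v} → Factor w v → Universal v → Universal w
universal-factor f univ s pos = InL-factor s f (univ s pos)

universal-complement : ∀ {w} → Universal w → Universal (complement w)
universal-complement univ s pos = InL-complement s pos (univ s pos)

universal-0110 : Universal (false ∷ true ∷ true ∷ false ∷ [])
universal-0110 s pos = 1 , factor-across (suffix-power _ (s 0) (pos 0)) (prefix-power _ (s 0) (pos 0))

universal-1010 : Universal (true ∷ false ∷ true ∷ false ∷ [])
universal-1010 s pos = 2 , factor-across
  (suffix-trans (suffix-trans (suffix-power _ (s 0) (pos 0)) (suffix-++ _ _)) (suffix-power _ (s 1) (pos 1)))
  (prefix-trans (prefix-map not (prefix-trans (prefix-power _ (s 0) (pos 0)) (prefix-++ _ _)))
                (prefix-power _ (s 1) (pos 1)))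

universal-≤2 : ∀ v → length v ≤ 2 → Universal v
universal-≤2 []                     _ = universal-factor ([] , _ , refl) universal-0110
universal-≤2 (false ∷ [])           _ = universal-factor ([] , _ , refl) universal-0110
universal-≤2 (true ∷ [])            _ = universal-factor (_ ∷ [] , _ , refl) universal-0110
universal-≤2 (false ∷ false ∷ [])   _ = universal-complement (universal-factor (_ ∷ [] , _ , refl) universal-0110)
universal-≤2 (false ∷ true ∷ [])    _ = universal-factor ([] , _ , refl) universal-0110
universal-≤2 (true ∷ false ∷ [])    _ = universal-factor (_ ∷ _ ∷ [] , [] , refl) universal-0110
universal-≤2 (true ∷ true ∷ [])     _ = universal-factor (_ ∷ [] , _ , refl) universal-0110
universal-≤2 (_ ∷ _ ∷ _ ∷ _) (s≤s (s≤s ()))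

universal-xxx̄ : ∀ x → Universal (x ∷ x ∷ not x ∷ [])
universal-xxx̄ false = universal-complement (universal-factor (_ ∷ [] , [] , refl) universal-0110)
universal-xxx̄ true  = universal-factor (_ ∷ [] , [] , refl) universal-0110

universal-xx̄x̄ : ∀ x → Universal (x ∷ not x ∷ not x ∷ [])
universal-xx̄x̄ false = universal-factor ([] , _ , refl) universal-0110
universal-xx̄x̄ true  = universal-complement (universal-factor ([] , _ , refl) universal-0110)

universal-101 : Universal (true ∷ false ∷ true ∷ [])
universal-101 = universal-factor ([] , _ , refl) universal-1010

block-double-free : ∀ c h z e m → block c h ≢ z ++ e ∷ e ∷ m
block-double-free zero          h []          e m ()
block-double-free zero          h (_ ∷ _)     e m ()
block-double-free (suc c)       h []          e m eq with ∷-injective eq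
... | refl , eq′ = not-¬ refl (sym (proj₁ (∷-injective eq′)))
block-double-free (suc zero)    h (_ ∷ [])    e m eq with ∷-injective eq
... | refl , eq′ with ∷-injective eq′
...   | refl , ()
block-double-free (suc (suc c)) h (_ ∷ [])    e m eq with ∷-injective eq
... | refl , eq′ with ∷-injective eq′
...   | refl , eq″ = not-¬ refl (proj₁ (∷-injective eq″))
block-double-free (suc c)       h (_ ∷ _ ∷ z) e m eq with ∷-injective eq
... | refl , eq′ = block-double-free c h z e m (proj₂ (∷-injective eq′))

θ-double : ∀ c u z e r → θ c u ≡ z ++ e ∷ e ∷ r →
  ∃₂ λ u₁ u₂ → u ≡ u₁ ++ u₂ × θ c u₁ ≡ z ++ [ e ] × θ c u₂ ≡ e ∷ r
θ-double c []      []      e r ()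
θ-double c []      (_ ∷ _) e r ()
θ-double c (h ∷ u) z e r eq with ++-split (block c h) (θ c u) z (e ∷ e ∷ r) eq
... | inj₁ (m , refl , eq′) with θ-double c u m e r eq′
...   | u₁ , u₂ , refl , eq₁ , eq₂ =
  h ∷ u₁ , u₂ , refl , trans (cong (block c h ++_) eq₁) (sym (++-assoc (block c h) m [ e ])) , eq₂
θ-double c (h ∷ u) z e r eq | inj₂ ([] , block≡ , eq′) with θ-double c u [] e r (sym eq′)
...   | u₁ , u₂ , refl , eq₁ , eq₂ =
  h ∷ u₁ , u₂ , refl , cong₂ _++_ (trans block≡ (++-identityʳ z)) eq₁ , eq₂
θ-double c (h ∷ u) z e r eq | inj₂ (_ ∷ [] , block≡ , eq′) with ∷-injective eq′
...   | refl , eq″ = [ h ] , u , refl , trans (++-identityʳ _) block≡ , sym eq″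
θ-double c (h ∷ u) z e r eq | inj₂ (_ ∷ _ ∷ m , block≡ , eq′) with ∷-injective eq′
...   | refl , eq″ with ∷-injective eq″
...     | refl , _ = ⊥-elim (block-double-free c h z e m block≡)

θ-split : ∀ c u j {A B} → θ c u ≡ A ++ B → length A ≡ j * (c * 2) →
  θ c (take j u) ≡ A × θ c (drop j u) ≡ B
θ-split c u j {A} {B} eq lenA = ++-cancel-length (θ c (take j u)) A length-prefix
  (trans (sym (θ-++ c (take j u) (drop j u))) (trans (cong (θ c) (take++drop≡id j u)) eq))
  where
  open ≡-Reasoning
  length-prefix : length (θ c (take j u)) ≡ length A
  length-prefix = begin
    length (θ c (take j u))              ≡⟨ length-θ c (take j u) ⟩
    length (take j u) * (c * 2)          ≡⟨ cong (_* (c * 2)) (length-take j u) ⟩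
    (j ⊓ length u) * (c * 2)             ≡⟨ *-distribʳ-⊓ (c * 2) j (length u) ⟩
    (j * (c * 2)) ⊓ (length u * (c * 2)) ≡⟨ sym (cong₂ _⊓_ lenA (length-θ c u)) ⟩
    length A ⊓ length (θ c u)            ≡⟨ m≤n⇒m⊓n≡m (subst (length A ≤_) (cong length (sym eq)) (length-++ˡ-≤ A B)) ⟩
    length A                             ∎

θ-injective : ∀ c {u v} → θ (suc c) u ≡ θ (suc c) v → u ≡ v
θ-injective c {[]}    {[]}    _ = refl
θ-injective c {[]}    {_ ∷ _} ()
θ-injective c {_ ∷ _} {[]}    ()
θ-injective c {h ∷ u} {_ ∷ v} eq with ∷-injective eq
... | refl , _ = cong (h ∷_) (θ-injective c (++-cancelˡ (block (suc c) h) (θ (suc c) u) (θ (suc c) v) eq))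

θ-cancelˡ : ∀ c w {u B} → θ (suc c) u ≡ θ (suc c) w ++ B → ∃ λ b → u ≡ w ++ b × θ (suc c) b ≡ B
θ-cancelˡ c w {u} eq =
  drop j u , trans (sym (take++drop≡id j u)) (cong (_++ drop j u) (θ-injective c (proj₁ split))) , proj₂ split
  where
  j = length w
  split = θ-split (suc c) u j eq (length-θ (suc c) w)

θ-cancelʳ : ∀ c w {u A} → θ (suc c) u ≡ A ++ θ (suc c) w → ∃ λ a → u ≡ a ++ w × θ (suc c) a ≡ A
θ-cancelʳ c w {u} {A} eq =
  take j u , trans (sym (take++drop≡id j u)) (cong (take j u ++_) (θ-injective c (proj₂ split))) , proj₁ split
  where
  open ≡-Reasoning
  K = suc c * 2
  j = length u ∸ length w
  lenA : length A ≡ j * K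
  lenA = begin
    length A                                        ≡⟨ sym (m+n∸n≡m (length A) (length w * K)) ⟩
    length A + length w * K ∸ length w * K          ≡⟨ cong (λ n → length A + n ∸ length w * K) (sym (length-θ (suc c) w)) ⟩
    length A + length (θ (suc c) w) ∸ length w * K  ≡⟨ cong (_∸ length w * K) (sym (length-++ A)) ⟩
    length (A ++ θ (suc c) w) ∸ length w * K        ≡⟨ cong (λ v → length v ∸ length w * K) (sym eq) ⟩
    length (θ (suc c) u) ∸ length w * K             ≡⟨ cong (_∸ length w * K) (length-θ (suc c) u) ⟩
    length u * K ∸ length w * K                     ≡⟨ sym (*-distribʳ-∸ K (length u) (length w)) ⟩
    j * K                                           ∎
  split = θ-split (suc c) u j eq lenA

θ-last : ∀ c {u P x} → θ (suc c) u ≡ P ++ [ not x ] → ∃ λ u′ → u ≡ u′ ++ [ x ]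
θ-last c {u} eq with initLast u
θ-last c {P = []}    () | []
θ-last c {P = _ ∷ _} () | []
θ-last c {P = P} eq | u′ ∷ʳ′ h =
  u′ , cong (u′ ∷ʳ_) (not-injective (proj₂ (∷ʳ-injective _ P (trans (sym (θ-∷ʳ c u′ h)) eq))))

θ-head : ∀ c {u y X} → θ (suc c) u ≡ y ∷ X → ∃ λ u′ → u ≡ y ∷ u′
θ-head c {g ∷ u′} eq with ∷-injective eq
... | refl , _ = u′ , refl

-- The flip p p̄ becomes the double letter p̄ p̄ of θ v, which pins down where θ v sits inside θ u.
HasFlip : Word → Set
HasFlip v = ∃ λ v₁ → ∃ λ p → ∃ λ v₂ → v ≡ v₁ ++ p ∷ not p ∷ v₂

hasFlip⇒length : ∀ {v} → HasFlip v → 2 ≤ length v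
hasFlip⇒length (v₁ , p , v₂ , refl) = ≤-trans (s≤s (s≤s z≤n)) (length-++ʳ-≤ v₁ (p ∷ not p ∷ v₂))

block-hasFlip : ∀ {n} x → 1 ≤ n → HasFlip (block n x)
block-hasFlip {suc n} x _ = [] , x , block n x , refl

θ-hasFlip : ∀ c {v} → HasFlip v → HasFlip (θ (suc c) v)
θ-hasFlip c (v₁ , p , v₂ , refl) =
  θ (suc c) v₁ , p , block c p ++ θ (suc c) (not p ∷ v₂) , θ-++ (suc c) v₁ (p ∷ not p ∷ v₂)

θ-sync : ∀ c {u v} P X → HasFlip v → θ (suc c) u ≡ P ++ θ (suc c) v ++ X →
  ∃₂ λ u₁ u₂ → u ≡ u₁ ++ v ++ u₂ × θ (suc c) u₁ ≡ P × θ (suc c) u₂ ≡ X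
θ-sync c {u} P X (v₁ , p , v₂ , refl) eq =
  synchronise (θ-double (suc c) u (P ++ Y) (not p) (T ++ X) (trans eq double-at-flip))
  where
  Y = θ (suc c) v₁ ++ block c p ++ [ p ]
  T = not (not p) ∷ block c (not p) ++ θ (suc c) v₂
  double-at-flip : P ++ θ (suc c) (v₁ ++ p ∷ not p ∷ v₂) ++ X ≡ (P ++ Y) ++ not p ∷ not p ∷ T ++ X
  double-at-flip = begin
    P ++ θ (suc c) (v₁ ++ p ∷ not p ∷ v₂) ++ X
      ≡⟨ cong (λ v → P ++ θ (suc c) v ++ X) (sym (++-assoc v₁ [ p ] (not p ∷ v₂))) ⟩
    P ++ θ (suc c) ((v₁ ∷ʳ p) ++ not p ∷ v₂) ++ X
      ≡⟨ cong (λ w → P ++ w ++ X) (θ-++ (suc c) (v₁ ∷ʳ p) (not p ∷ v₂)) ⟩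
    P ++ (θ (suc c) (v₁ ∷ʳ p) ++ not p ∷ T) ++ X
      ≡⟨ cong (λ w → P ++ (w ++ not p ∷ T) ++ X) (θ-∷ʳ c v₁ p) ⟩
    P ++ ((Y ++ [ not p ]) ++ not p ∷ T) ++ X
      ≡⟨ reassoc P Y [ not p ] (not p ∷ T) X ⟩
    (P ++ Y) ++ not p ∷ not p ∷ T ++ X
      ∎
    where
    open ≡-Reasoning
    reassoc : ∀ (P Y Z W X : Word) → P ++ ((Y ++ Z) ++ W) ++ X ≡ (P ++ Y) ++ Z ++ W ++ X
    reassoc P Y Z W X = solve (++-monoid Bool)
  synchronise : (∃₂ λ u₁ u₂ → u ≡ u₁ ++ u₂ × θ (suc c) u₁ ≡ (P ++ Y) ++ [ not p ] × θ (suc c) u₂ ≡ not p ∷ T ++ X) →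
    ∃₂ λ u₁ u₂ → u ≡ u₁ ++ (v₁ ++ p ∷ not p ∷ v₂) ++ u₂ × θ (suc c) u₁ ≡ P × θ (suc c) u₂ ≡ X
  synchronise (u₁ , u₂ , refl , eq₁ , eq₂)
    with θ-cancelʳ c (v₁ ∷ʳ p) {u₁} (trans eq₁ (trans (++-assoc P Y [ not p ]) (cong (P ++_) (sym (θ-∷ʳ c v₁ p)))))
       | θ-cancelˡ c (not p ∷ v₂) {u₂} eq₂
  ... | a , refl , eq₃ | b , refl , eq₄ = a , b , reassoc a v₁ [ p ] (not p ∷ v₂) b , eq₃ , eq₄
    where
    reassoc : ∀ (A V Z W B : Word) → (A ++ V ++ Z) ++ W ++ B ≡ A ++ (V ++ Z ++ W) ++ B
    reassoc A V Z W B = solve (++-monoid Bool)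

θ-recognise : ∀ c {u x v y} → HasFlip v → Factor (not x ∷ θ (suc c) v ++ [ y ]) (θ (suc c) u) →
  Factor (x ∷ v ++ [ y ]) u
θ-recognise c {u} {x} {v} {y} flip (P , X , eq)
  with θ-sync c {u} (P ++ [ not x ]) (y ∷ X) flip (sym (trans (reassoc P [ not x ] (θ (suc c) v) [ y ] X) eq))
  where
  reassoc : ∀ (P Z W V X : Word) → (P ++ Z) ++ W ++ V ++ X ≡ P ++ (Z ++ W ++ V) ++ X
  reassoc P Z W V X = solve (++-monoid Bool)
... | u₁ , u₂ , refl , eq₁ , eq₂ with θ-last c {u₁} eq₁ | θ-head c {u₂} eq₂
...   | u₁′ , refl | u₂′ , refl = u₁′ , u₂′ , reassoc u₁′ [ x ] v [ y ] u₂′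
  where
  reassoc : ∀ (A Z V W B : Word) → A ++ (Z ++ V ++ W) ++ B ≡ (A ++ Z) ++ V ++ W ++ B
  reassoc A Z V W B = solve (++-monoid Bool)

θ-bordered : ∀ c x v y → Factor (not x ∷ θ (suc c) v ++ [ y ]) (θ (suc c) (x ∷ v ++ [ y ]))
θ-bordered c x v y = factor-across {m = [ not x ]} (block c x ++ [ x ] , sym (block-sucʳ c x))
  (not y ∷ block c y ++ [] , trans (++-assoc (θ (suc c) v) [ y ] _) (sym (θ-++ (suc c) v [ y ])))

prefix-θ-take : ∀ c n u {Q} → Prefix Q (θ c u) → length Q ≤ n * (c * 2) → Prefix Q (θ c (take n u))
prefix-θ-take c n u {Q} pre lenQ = prefix-++⁻ (θ c (take n u)) (θ c (drop n u))
  (subst (Prefix Q) (trans (cong (θ c) (sym (take++drop≡id n u))) (θ-++ c (take n u) (drop n u))) pre)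
  (begin
    length Q                              ≤⟨ ⊓-glb lenQ (≤-trans (prefix-length pre) (≤-reflexive (length-θ c u))) ⟩
    (n * (c * 2)) ⊓ (length u * (c * 2))  ≡⟨ sym (*-distribʳ-⊓ (c * 2) n (length u)) ⟩
    (n ⊓ length u) * (c * 2)              ≡⟨ cong (_* (c * 2)) (sym (length-take n u)) ⟩
    length (take n u) * (c * 2)           ≡⟨ sym (length-θ c (take n u)) ⟩
    length (θ c (take n u))               ∎)
  where
  open ≤-Reasoning
  prefix-length : ∀ {a b} → Prefix a b → length a ≤ length b
  prefix-length {a} (x , refl) = length-++ˡ-≤ a x

window : ∀ c j u {w} → Factor w (θ c u) → length w ≤ j * (c * 2) + 1 →
  ∃ λ v → Factor v u × length v ≤ suc j × Factor w (θ c v)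
window c j [] {w} (P , X , eq) _ rewrite ++-conicalˡ w X (++-conicalʳ P (w ++ X) eq) =
  [] , factor-refl [] , z≤n , factor-refl []
window c j (h ∷ u) {w} (P , X , eq) lenw with ++-split P (w ++ X) (block c h) (θ c u) eq
... | inj₂ (m , refl , eq′) = let v , v⊑u , lenv , w⊑θv = window c j u (m , X , sym eq′) lenw
                              in v , factor-∷ h v⊑u , lenv , w⊑θv
... | inj₁ ([] , _ , eq′)    = let v , v⊑u , lenv , w⊑θv = window c j u ([] , X , eq′) lenw
                              in v , factor-∷ h v⊑u , lenv , w⊑θv
... | inj₁ (m@(_ ∷ _) , block≡ , eq′) =
  take (suc j) (h ∷ u) , prefix⇒factor (drop (suc j) (h ∷ u) , take++drop≡id (suc j) (h ∷ u)) ,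
  ≤-trans (≤-reflexive (length-take (suc j) (h ∷ u))) (m⊓n≤m (suc j) _) ,
  (P , proj₁ starts-early , trans (sym (++-assoc P w _)) (proj₂ starts-early))
  where
  K = c * 2
  P<K : length P < K
  P<K = subst (length P <_) (trans (sym (length-++ P)) (trans (cong length (sym block≡)) (length-block c h)))
          (m<m+n (length P) (s≤s z≤n))
  starts-early : Prefix (P ++ w) (θ c (take (suc j) (h ∷ u)))
  starts-early = prefix-θ-take c (suc j) (h ∷ u) (X , trans (++-assoc P w X) eq) (begin
    length (P ++ w)              ≡⟨ length-++ P ⟩
    length P + length w          ≤⟨ +-monoʳ-≤ (length P) lenw ⟩
    length P + (j * K + 1)       ≡⟨ cong (length P +_) (+-comm (j * K) 1) ⟩
    length P + suc (j * K)       ≡⟨ +-suc (length P) (j * K) ⟩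
    suc (length P) + j * K       ≤⟨ +-monoˡ-≤ (j * K) P<K ⟩
    K + j * K                    ∎)
    where open ≤-Reasoning

_⊆[_]_ : Seq → ℕ → Seq → Set
s ⊆[ n ] t = ∀ w → length w ≤ n → InL s w → InL t w

⊆[]-mono : ∀ {s t m n} → m ≤ n → s ⊆[ n ] t → s ⊆[ m ] t
⊆[]-mono m≤n s⊆t w lenw = s⊆t w (≤-trans lenw m≤n)

transfer : ∀ s t c j → Positive s → s 0 ≡ c → t 0 ≡ c → shift s ⊆[ suc j ] shift t → s ⊆[ j * (c * 2) + 1 ] t
transfer s t c j poss refl t₀≡c sub w lenw w∈s with InL-desubst s poss w∈s
... | u , u∈ , w⊑θu with window (s 0) j u w⊑θu lenw
... | v , v⊑u , lenv , w⊑θv =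
  InL-subst t (sub v lenv (InL-factor (shift s) v⊑u u∈)) (subst (λ c → Factor w (θ c v)) (sym t₀≡c) w⊑θv)

θ-factor-mono-≤2 : ∀ {a b} → a ≤ b → ∀ v → length v ≤ 2 → Factor (θ a v) (θ b v)
θ-factor-mono-≤2 a≤b []           _ = factor-refl []
θ-factor-mono-≤2 a≤b (x ∷ [])     _ = factor-across (power-suffix _ a≤b) (prefix-++ [] [])
θ-factor-mono-≤2 a≤b (x ∷ y ∷ []) _ = factor-across (power-suffix _ a≤b)
  (subst₂ Prefix (sym (++-identityʳ _)) (sym (++-identityʳ _)) (power-prefix _ a≤b))
θ-factor-mono-≤2 a≤b (_ ∷ _ ∷ _ ∷ _) (s≤s (s≤s ()))

short-⊆ : ∀ s t → Positive s → Positive t → s 0 ≤ t 0 → s ⊆[ s 0 * 2 + 1 ] t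
short-⊆ s t poss post s₀≤t₀ w lenw w∈s with InL-desubst s poss w∈s
... | u , _ , w⊑θu with window (s 0) 1 u w⊑θu (subst (λ n → length w ≤ n + 1) (sym (+-identityʳ _)) lenw)
... | v , _ , lenv , w⊑θv =
  InL-subst t (universal-≤2 v lenv (shift t) (post ∘ suc)) (factor-trans w⊑θv (θ-factor-mono-≤2 s₀≤t₀ v lenv))

block-factor⇒prefix : ∀ x n {w} → Factor w (block n x) → ∃ λ z → Prefix w (block n z)
block-factor⇒prefix x zero    {[]}    _                 = x , [] , refl
block-factor⇒prefix x zero    {_ ∷ _} ([] , _ , ())
block-factor⇒prefix x zero    {_ ∷ _} (_ ∷ _ , _ , ())
block-factor⇒prefix x (suc n) ([] , X , eq)             = x , X , eq
block-factor⇒prefix x (suc n) (_ ∷ [] , X , eq)         = not x , subst (Prefix _) (sym block-not)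
  (prefix-trans (X , trans (proj₂ (∷-injective eq)) (power-rotate x (not x) n))
    ([ x ] , trans (++-assoc (power (not x ∷ x ∷ []) n) [ not x ] [ x ]) (sym (power-sucʳ _ n))))
  where
  block-not : block (suc n) (not x) ≡ power (not x ∷ x ∷ []) (suc n)
  block-not = cong (λ z → power (not x ∷ z ∷ []) (suc n)) (not-involutive x)
block-factor⇒prefix x (suc n) (_ ∷ _ ∷ P , X , eq)
  with block-factor⇒prefix x n (P , X , proj₂ (∷-injective (proj₂ (∷-injective eq))))
... | z , w⊑ = z , prefix-trans w⊑ (power-prefix _ (n≤1+n n))

θ-xxx̄ : ∀ a x → θ a (x ∷ x ∷ not x ∷ []) ≡ block (a + a) x ++ block a (not x)
θ-xxx̄ a x = begin
  block a x ++ block a x ++ block a (not x) ++ []  ≡⟨ cong (λ z → block a x ++ block a x ++ z) (++-identityʳ _) ⟩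
  block a x ++ block a x ++ block a (not x)        ≡⟨ sym (++-assoc (block a x) (block a x) _) ⟩
  (block a x ++ block a x) ++ block a (not x)      ≡⟨ cong (_++ block a (not x)) (sym (power-+ _ a a)) ⟩
  block (a + a) x ++ block a (not x)               ∎
  where open ≡-Reasoning

θ-xx̄x̄ : ∀ a x → θ a (x ∷ not x ∷ not x ∷ []) ≡ block a x ++ block (a + a) (not x)
θ-xx̄x̄ a x = cong (block a x ++_) (trans (cong (block a (not x) ++_) (++-identityʳ _)) (sym (power-+ _ a a)))

m*2+2≤[m+m]*2 : ∀ {a} → 1 ≤ a → a * 2 + 2 ≤ (a + a) * 2
m*2+2≤[m+m]*2 {a} 1≤a = ≤-trans (+-monoʳ-≤ (a * 2) (*-monoˡ-≤ 2 1≤a)) (≤-reflexive (sym (*-distribʳ-+ 2 a a)))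

Universalθ : ℕ → Word → Set
Universalθ a w = ∃ λ v → Universal v × Factor w (θ a v)

short-factor-block : ∀ {a} → 1 ≤ a → ∀ x n {w} → Factor w (block n x) → length w ≤ a * 2 + 2 → Universalθ a w
short-factor-block {a} 1≤a x n f lenw with block-factor⇒prefix x n f
... | z , pre = _ , universal-xxx̄ z , prefix⇒factor (subst (Prefix _) (sym (θ-xxx̄ a z))
  (prefix-trans (prefix-power⁻ _ (a + a) n pre (≤-trans lenw (m*2+2≤[m+m]*2 1≤a))) (prefix-++ _ _)))

short-straddle : ∀ {a} → 1 ≤ a → ∀ x b {m n} → Suffix m (block b x) → Prefix n (block b (not x)) →
  length (m ++ n) ≤ a * 2 + 2 → Universalθ a (m ++ n)
short-straddle {a} 1≤a x b {m} {n} suf pre len with length m ≤? a * 2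
... | yes m≤ = _ , universal-xx̄x̄ x , subst (Factor _) (sym (θ-xx̄x̄ a x)) (factor-across
  (suffix-power⁻ _ a b suf m≤)
  (prefix-power⁻ _ (a + a) b pre (≤-trans (length-++ʳ-≤ m n) (≤-trans len (m*2+2≤[m+m]*2 1≤a)))))
... | no m≰ = _ , universal-xxx̄ x , subst (Factor _) (sym (θ-xxx̄ a x)) (factor-across
  (suffix-power⁻ _ (a + a) b suf (≤-trans (length-++ˡ-≤ m n) (≤-trans len (m*2+2≤[m+m]*2 1≤a))))
  (prefix-power⁻ _ a b pre (≤-trans n≤1 (≤-trans 1≤a (m≤m*n a 2)))))
  where
  open ≤-Reasoning
  n≤1 : length n ≤ 1
  n≤1 = ≤-pred (+-cancelˡ-≤ (a * 2) (suc (length n)) 2 (begin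
    a * 2 + suc (length n)  ≡⟨ +-suc (a * 2) (length n) ⟩
    suc (a * 2) + length n  ≤⟨ +-monoˡ-≤ (length n) (≰⇒> m≰) ⟩
    length m + length n     ≡⟨ sym (length-++ m) ⟩
    length (m ++ n)         ≤⟨ len ⟩
    a * 2 + 2               ∎))

short-factor-θ : ∀ {a b} → 1 ≤ a → ∀ v {w} → length v ≤ 2 → Factor w (θ b v) → length w ≤ a * 2 + 2 →
  Universalθ a w
short-factor-θ 1≤a [] {w} _ (P , X , eq) _ rewrite ++-conicalˡ w X (++-conicalʳ P (w ++ X) eq) =
  [] , universal-≤2 [] z≤n , factor-refl []
short-factor-θ {b = b} 1≤a (x ∷ []) _ f =
  short-factor-block 1≤a x b (subst (Factor _) (++-identityʳ (block b x)) f)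
short-factor-θ {a} {b} 1≤a (x ∷ y ∷ []) {w} _ f lenw with x ≟ y
... | yes refl = short-factor-block 1≤a x (b + b)
  (subst (Factor w) (trans (cong (block b x ++_) (++-identityʳ _)) (sym (power-+ _ b b))) f) lenw
... | no x≢y rewrite ¬-not (x≢y ∘ sym) with factor-++⁻ w (block b x) (block b (not x))
                                              (subst (Factor w) (cong (block b x ++_) (++-identityʳ _)) f)
...   | inj₁ f′                               = short-factor-block 1≤a x b f′ lenw
...   | inj₂ (inj₁ f′)                        = short-factor-block 1≤a (not x) b f′ lenw
...   | inj₂ (inj₂ (m , n , refl , suf , pre)) = short-straddle 1≤a x b suf pre lenw
short-factor-θ 1≤a (_ ∷ _ ∷ _ ∷ _) (s≤s (s≤s ()))

m<n⇒m*2+2≤1*[n*2]+1 : ∀ {a b} → a < b → a * 2 + 2 ≤ 1 * (b * 2) + 1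
m<n⇒m*2+2≤1*[n*2]+1 {a} {b} a<b = begin
  a * 2 + 2       ≡⟨ +-comm (a * 2) 2 ⟩
  suc a * 2       ≤⟨ *-monoˡ-≤ 2 a<b ⟩
  b * 2           ≡⟨ sym (+-identityʳ (b * 2)) ⟩
  1 * (b * 2)     ≤⟨ m≤m+n (1 * (b * 2)) 1 ⟩
  1 * (b * 2) + 1 ∎
  where open ≤-Reasoning

short-⊇ : ∀ s t → Positive s → Positive t → s 0 < t 0 → t ⊆[ s 0 * 2 + 2 ] s
short-⊇ s t poss post s₀<t₀ w lenw w∈t with InL-desubst t post w∈t
... | u , _ , w⊑θu with window (t 0) 1 u w⊑θu (≤-trans lenw (m<n⇒m*2+2≤1*[n*2]+1 s₀<t₀))
... | v , _ , lenv , w⊑θv with short-factor-θ (poss 0) v lenv w⊑θv lenw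
... | v′ , univ , w⊑θv′ = InL-subst s (univ (shift s) (poss ∘ suc)) w⊑θv′

separator : ℕ → Word
separator a = false ∷ block a false ++ [ true ]

separator-factor : ∀ a → 1 ≤ a → Factor (separator a) (θ a (true ∷ false ∷ true ∷ []))
separator-factor (suc a) _ = factor-across {m = [ false ]}
  (suffix-trans ([ true ] , refl) (suffix-power (true ∷ false ∷ []) (suc a) (s≤s z≤n)))
  (false ∷ block a true ++ [] , ++-assoc (block (suc a) false) [ true ] _)

no-multiple : ∀ n {m k} → 0 < m → m < k → n * k ≢ m
no-multiple zero    0<m _   refl = <-irrefl refl 0<m
no-multiple (suc n) _   m<k eq   = <⇒≱ m<k (≤-trans (m≤m+n _ (n * _)) (≤-reflexive eq))

-- The double letters 00 and 11 of the separator are 2a apart, whereas the double letters of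
-- θ b u sit at block boundaries, a multiple of 2b apart.
separator-not-factor : ∀ a b u → 1 ≤ a → a < b → ¬ Factor (separator a) (θ b u)
separator-not-factor (suc a) b u _ a<b (P , X , eq)
  with θ-double b u P false (true ∷ (block a false ++ [ true ]) ++ X) (sym eq)
... | _ , u₂ , _ , _ , eq₂ with θ-double b u₂ (block a false ++ [ false ]) true X (trans eq₂ second-double)
  where
  second-double : (block (suc a) false ++ [ true ]) ++ X ≡ (block a false ++ [ false ]) ++ true ∷ true ∷ X
  second-double = trans (cong (λ z → (z ++ [ true ]) ++ X) (block-sucʳ a false))
                        (reassoc (block a false) [ false ] [ true ] [ true ] X)
    where
    reassoc : ∀ (A B C D X : Word) → (((A ++ B) ++ C) ++ D) ++ X ≡ (A ++ B) ++ C ++ D ++ X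
    reassoc A B C D X = solve (++-monoid Bool)
... | u₂₁ , _ , _ , eq₃ , _ = no-multiple (length u₂₁) (s≤s z≤n) (*-monoˡ-< 2 a<b) (begin
  length u₂₁ * (b * 2)                              ≡⟨ sym (length-θ b u₂₁) ⟩
  length (θ b u₂₁)                                  ≡⟨ cong length eq₃ ⟩
  length ((block a false ++ [ false ]) ++ [ true ]) ≡⟨ cong length (sym (block-sucʳ a false)) ⟩
  length (block (suc a) false)                      ≡⟨ length-block (suc a) false ⟩
  suc a * 2                                         ∎)
  where open ≡-Reasoning

-- The separating word is x v y; its length is the M of the theorem.
record Separation (s t : Seq) : Set where
  field
    x y       : Bool
    v         : Word
    flip      : HasFlip v
    s∋witness : InL s (x ∷ v ++ [ y ])
    t∌witness : ¬ InL t (x ∷ v ++ [ y ])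
    s⊆t       : s ⊆[ suc (length v) ] t
    t⊆s       : t ⊆[ suc (suc (length v)) ] s

separation-base : ∀ s t → Positive s → Positive t → s 0 < t 0 → Separation s t
separation-base s t poss post s₀<t₀ = record
  { x = false ; y = true ; v = block (s 0) false
  ; flip      = block-hasFlip false (poss 0)
  ; s∋witness = InL-subst s (universal-101 (shift s) (poss ∘ suc)) (separator-factor (s 0) (poss 0))
  ; t∌witness = λ w∈t → let u , _ , w⊑θu = InL-desubst t post w∈t in
                  separator-not-factor (s 0) (t 0) u (poss 0) s₀<t₀ w⊑θu
  ; s⊆t       = ⊆[]-mono (≤-reflexive (trans (cong suc (length-block (s 0) false)) (+-comm 1 (s 0 * 2))))
                  (short-⊆ s t poss post (<⇒≤ s₀<t₀))
  ; t⊆s       = ⊆[]-mono (≤-reflexive (trans (cong (suc ∘ suc) (length-block (s 0) false)) (+-comm 2 (s 0 * 2))))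
                  (short-⊇ s t poss post s₀<t₀)
  }

separation-lift : ∀ s t c → Positive s → Positive t → s 0 ≡ suc c → t 0 ≡ suc c →
  Separation (shift s) (shift t) → Separation s t
separation-lift s t c poss post s₀≡ t₀≡ sep = record
  { x = not x ; y = y ; v = θ (suc c) v
  ; flip      = θ-hasFlip c flip
  ; s∋witness = InL-subst s s∋witness (subst (λ a → Factor W′ (θ a (x ∷ v ++ [ y ]))) (sym s₀≡) (θ-bordered c x v y))
  ; t∌witness = λ w∈t → let u , u∈ , w⊑θu = InL-desubst t post w∈t in
                  t∌witness (InL-factor (shift t) (θ-recognise c flip (subst (λ a → Factor W′ (θ a u)) t₀≡ w⊑θu)) u∈)
  ; s⊆t       = ⊆[]-mono (≤-reflexive (trans (cong suc (length-θ (suc c) v)) (+-comm 1 _)))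
                  (transfer s t (suc c) (length v) poss s₀≡ t₀≡ s⊆t)
  ; t⊆s       = ⊆[]-mono bound (transfer t s (suc c) (suc (length v)) post t₀≡ s₀≡ t⊆s)
  }
  where
  open Separation sep
  W′ = not x ∷ θ (suc c) v ++ [ y ]
  K = suc c * 2
  bound : suc (suc (length (θ (suc c) v))) ≤ suc (length v) * K + 1
  bound = begin
    2 + length (θ (suc c) v)   ≡⟨ cong (2 +_) (length-θ (suc c) v) ⟩
    2 + length v * K           ≤⟨ +-monoˡ-≤ (length v * K) (m≤m+n 2 (c * 2)) ⟩
    K + length v * K           ≤⟨ m≤m+n _ 1 ⟩
    suc (length v) * K + 1     ∎
    where open ≤-Reasoning

separation : ∀ k s t → Positive s → Positive t → (∀ j → j < k → s j ≡ t j) → s k < t k → Separation s t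
separation zero    s t poss post _     s₀<t₀ = separation-base s t poss post s₀<t₀
separation (suc k) s t poss post agree sₖ<tₖ =
  let c , s₀≡ = m≤n⇒∃[o]m+o≡n (poss 0) in
  separation-lift s t c poss post (sym s₀≡) (trans (sym (agree 0 (s≤s z≤n))) (sym s₀≡))
    (separation k (shift s) (shift t) (poss ∘ suc) (post ∘ suc) (λ j j<k → agree (suc j) (s≤s j<k)) sₖ<tₖ)

proposition2p5 : (s t : Seq) → Positive s → Positive t → LexLess s t →
    ∃ λ (M : ℕ) → 3 ≤ M × (∀ n → n < M → SameLangAt s t n) × StrictSupersetAt s t M
proposition2p5 s t poss post (k , agree , sₖ<tₖ) =
  length W , subst (3 ≤_) (sym length-W) (s≤s (s≤s (≤-trans (s≤s z≤n) (hasFlip⇒length flip)))) ,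
  (λ n n<M w lenw → let short = ≤-pred (subst (suc (length w) ≤_) length-W (subst (_< length W) (sym lenw) n<M))
                    in s⊆t w short , t⊆s w (≤-trans short (n≤1+n _))) ,
  ((λ w lenw → t⊆s w (≤-reflexive (trans lenw length-W))) , W , refl , s∋witness , t∌witness)
  where
  open Separation (separation k s t poss post agree sₖ<tₖ)
  W = x ∷ v ++ [ y ]
  length-W : length W ≡ suc (suc (length v))
  length-W = cong suc (trans (length-++ v) (+-comm (length v) 1))
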